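{- Let $G$ be a directed graph with root $r$ and a set $T$ of $q$ terminals, and let $H_\ell\subseteq G$ be rooted $\ell$-connected. Consider the iterative procedure that starts with $H:=H_\ell$ and, as long as $H$ has a deficient set, computes the cores of $H$ and adds to $H$ a set of edges of $G$ that covers at least a $1/9$ fraction of the Halo-families of the current $H$. Then the number of iterations is $O(\log q)$.
   Context: $H$ is rooted $\ell$-connected if it contains $\ell$ edge-disjoint $r\to t$ paths for every $t\in T\subseteq V\setminus\{r\}$. For a graph $H\supseteq H_\ell$, a deficient set is $U\subseteq V$ with $r\notin U$, $U\cap T\ne\emptyset$ and fewer than $\ell+1$ edges of $H$ entering $U$. A core is a deficient set properly containing no other deficient set; $\mathsf{Halo}(C)$ is the family of deficient sets containing the core $C$ and no other core. An edge set $E'$ covers $\mathsf{Halo}(C)$ if every member of $\mathsf{Halo}(C)$ has at least $\ell+1$ entering edges in $H\cup E'$. -}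

module Defs where

open import Data.Nat using (ℕ; zero; suc; _+_; _*_; _<ᵇ_; _≤_)
open import Data.Bool using (Bool; true; false; _∧_; _∨_; not; if_then_else_)
open import Data.Fin using (Fin; _≟_)
open import Data.Vec using (Vec; []; _∷_; lookup)
open import Data.List using (List; []; _∷_; map; _++_; allFin; filterᵇ; length; concat)
open import Data.Bool.ListAction using (all; any)
open import Data.Nat.ListAction using (sum)
open import Data.List.Relation.Unary.All using (All)
open import Data.List.Relation.Unary.Unique.Propositional using (Unique)
open import Data.Fin.Subset using (Subset; _∈_; _∉_; _∪_; ∣_∣)
open import Data.Product using (Σ; _×_)
open import Relation.Binary.PropositionalEquality using (_≡_)
open import Relation.Nullary.Decidable using (⌊_⌋)

-- A finite directed multigraph G on vertex set Fin n with edge set Fin m;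
-- edge e goes from tail e to head e.  Subgraphs H ⊆ G are edge subsets
-- (Subset m), vertex sets U ⊆ V are Subset n.
record Digraph (n m : ℕ) : Set where
  field
    tail : Fin m → Fin n
    head : Fin m → Fin n
open Digraph public

module _ {n m : ℕ} (G : Digraph n m) where

  data Walk (H : Subset m) : Fin n → Fin n → List (Fin m) → Set where
    nil  : ∀ {v} → Walk H v v []
    cons : ∀ {u v e es} → e ∈ H → tail G e ≡ u →
           Walk H (head G e) v es → Walk H u v (e ∷ es)

  Path : Subset m → Fin n → Fin n → List (Fin m) → Set
  Path H u v es = Walk H u v es × Unique (u ∷ map (head G) es)

  RootedConnected : Subset m → Fin n → Subset n → ℕ → Set
  RootedConnected H r T ℓ =
    ∀ t → t ∈ T →
      Σ (List (List (Fin m))) λ ps →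
        (length ps ≡ ℓ) × All (Path H r t) ps × Unique (concat ps)

  allSubsets : ∀ k → List (Subset k)
  allSubsets zero    = [] ∷ []
  allSubsets (suc k) = map (true ∷_) (allSubsets k) ++ map (false ∷_) (allSubsets k)

  mem : ∀ {k} → Subset k → Fin k → Bool
  mem U v = lookup U v

  inDeg : Subset m → Subset n → ℕ
  inDeg H U = sum (map (λ e → if mem H e ∧ not (mem U (tail G e)) ∧ mem U (head G e)
                               then 1 else 0) (allFin m))

  subsetᵇ : Subset n → Subset n → Bool
  subsetᵇ W U = all (λ v → not (mem W v) ∨ mem U v) (allFin n)

  eqᵇ : Subset n → Subset n → Bool
  eqᵇ W U = subsetᵇ W U ∧ subsetᵇ U W

  properSubsetᵇ : Subset n → Subset n → Bool
  properSubsetᵇ W U = subsetᵇ W U ∧ not (eqᵇ W U)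

  module _ (r : Fin n) (T : Subset n) (ℓ : ℕ) where

    deficient : Subset m → Subset n → Bool
    deficient H U = not (mem U r)
                  ∧ any (λ v → mem U v ∧ mem T v) (allFin n)
                  ∧ (inDeg H U <ᵇ suc ℓ)

    hasDeficient : Subset m → Bool
    hasDeficient H = any (deficient H) (allSubsets n)

    isCore : Subset m → Subset n → Bool
    isCore H C = deficient H C
               ∧ all (λ W → not (properSubsetᵇ W C ∧ deficient H W)) (allSubsets n)

    cores : Subset m → List (Subset n)
    cores H = filterᵇ (isCore H) (allSubsets n)

    inHalo : Subset m → Subset n → Subset n → Bool
    inHalo H C U = deficient H U ∧ subsetᵇ C U
                 ∧ all (λ C' → eqᵇ C' C ∨ not (subsetᵇ C' U)) (cores H)

    covers : Subset m → Subset m → Subset n → Bool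
    covers H E' C = all (λ U → not (inHalo H C U) ∨ not (inDeg (H ∪ E') U <ᵇ suc ℓ))
                        (allSubsets n)

    coveredHalos : Subset m → Subset m → ℕ
    coveredHalos H E' = length (filterᵇ (covers H E') (cores H))

    -- A run of k iterations of the procedure: H 0 = Hℓ, and at each
    -- iteration i < k the current H i has a deficient set, and E i ⊆ E(G)
    -- covers at least a 1/9 fraction of the Halo families of H i
    -- (9 · #covered ≥ #cores = #Halo families), and H (i+1) = H i ∪ E i.
    Run : Subset m → ℕ → (ℕ → Subset m) → (ℕ → Subset m) → Set
    Run Hℓ k H E =
      (H 0 ≡ Hℓ) ×
      (∀ i → suc i ≤ k →
         (hasDeficient (H i) ≡ true) ×
         (length (cores (H i)) ≤ 9 * coveredHalos (H i) (E i)) ×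
         (H (suc i) ≡ H i ∪ E i))

module Submission where

-- Every H ⊇ Hℓ satisfies the cut condition: a set U with r ∉ U meeting T has at least ℓ
-- entering edges.  With submodularity of in-degree, two deficient sets sharing a terminal
-- meet in a deficient set, so distinct cores are disjoint on T and there are at most |T|
-- of them.  After a round adding E, every core C′ of H ∪ E is deficient in H and hence
-- contains a core C of H; if E covers Halo(C), then C′ ∉ Halo(C), so C′ contains a second
-- core of H.  Weighting covered cores by 1 and uncovered ones by 2, every new core collects
-- weight at least 2 while every old core lies in at most one new core, so
-- 2·#cores(H ∪ E) ≤ 2·#cores(H) − #covered, and the 1/9 covering rate gives
-- 18·#cores(H ∪ E) ≤ 17·#cores(H).  As 2·17¹³ ≤ 18¹³, the number of cores halves every 13
-- rounds, and it stays positive while a deficient set exists.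

open import Data.Bool using (Bool; true; false; _∧_; _∨_; not; if_then_else_)
open import Data.Bool.ListAction using (all; any)
open import Data.Bool.Properties
  using (T-≡; ∧-conicalˡ; ∧-conicalʳ; ∨-conicalˡ; ∨-conicalʳ; not-injective)
open import Data.Empty using (⊥; ⊥-elim)
open import Data.Fin using (Fin)
import Data.Fin as Fin
open import Data.Fin.Subset using (Subset; _∈_; _∉_; _⊆_; _⊂_; _∩_; _∪_; ∣_∣)
open import Data.Fin.Subset.Properties
  using ( _∈?_; ⊆-refl; ⊆-trans; ⊆-antisym; x∈p∩q⁺; x∈p∩q⁻; x∈p∪q⁺; x∈p∪q⁻
        ; p∩q⊆p; p∩q⊆q; p⊆p∪q; p⊂q⇒∣p∣<∣q∣)
open import Data.List using (List; []; _∷_; _++_; map; length; concat; filterᵇ; allFin; tabulate)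
open import Data.List.Membership.Propositional using () renaming (_∈_ to _∈ₗ_)
open import Data.List.Membership.Propositional.Properties
  using (∈-allFin; ∈-map⁺; ∈-map⁻; ∈-++⁺ˡ; ∈-++⁺ʳ; ∈-concat⁺′; ∈-filter⁺; ∈-filter⁻)
open import Data.List.Properties using (map-tabulate)
open import Data.List.Relation.Unary.All as All using (All; []; _∷_)
open import Data.List.Relation.Unary.Any using (here; there)
open import Data.List.Relation.Unary.Unique.Propositional using (Unique; []; _∷_)
import Data.List.Relation.Unary.Unique.Propositional.Properties as Unique
open import Data.Nat using (ℕ; zero; suc; _+_; _*_; _^_; _≤_; _<_; _<ᵇ_; z≤n; s≤s; _≤?_; NonZero)
open import Data.Nat.Induction using (<-wellFounded)
open import Data.Nat.ListAction using (sum)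
open import Data.Nat.Logarithm using (⌊log₂_⌋; ⌊log₂⌋-mono-≤; ⌊log₂[2^n]⌋≡n)
open import Data.Nat.Properties
open import Algebra.Properties.CommutativeSemigroup +-commutativeSemigroup
  using () renaming (interchange to +-interchange)
open import Algebra.Properties.CommutativeSemigroup *-commutativeSemigroup
  using () renaming (interchange to *-interchange; x∙yz≈y∙xz to x*[y*z]≡y*[x*z])
open import Data.Product using (Σ; ∃; _×_; _,_; proj₁; proj₂)
open import Data.Sum using (inj₁; inj₂)
open import Data.Vec using ([]; _∷_; lookup)
open import Data.Vec.Properties using (lookup-zipWith; []=⇒lookup; lookup⇒[]=)
open import Defs
open import Function using (id; _∘_; _∋_; flip)
open import Function.Bundles using (Equivalence)
open import Induction.WellFounded using (Acc; acc)
open import Relation.Binary.Definitions using (DecidableEquality)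
open import Relation.Binary.PropositionalEquality
open import Relation.Nullary using (yes; no; does)
open import Relation.Nullary.Decidable using (T?)

private variable
  A B : Set

-- Defined by `if` rather than `Data.Bool.toℕ` so that `inDeg G H U` unfolds
-- definitionally to `∑[ e ← allFin m ] 𝟙 (entering G H U e)`.
𝟙 : Bool → ℕ
𝟙 b = if b then 1 else 0

∑ : List A → (A → ℕ) → ℕ
∑ xs f = sum (map f xs)

syntax ∑ xs (λ x → e) = ∑[ x ← xs ] e

∑-const : ∀ c (xs : List A) → ∑[ _ ← xs ] c ≡ length xs * c
∑-const c []       = refl
∑-const c (x ∷ xs) = cong (c +_) (∑-const c xs)

∑-+ : ∀ (f g : A → ℕ) xs → ∑[ x ← xs ] (f x + g x) ≡ ∑ xs f + ∑ xs g
∑-+ f g []       = refl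
∑-+ f g (x ∷ xs) =
  trans (cong (f x + g x +_) (∑-+ f g xs)) (+-interchange (f x) (g x) (∑ xs f) (∑ xs g))

∑-*ʳ : ∀ (f : A → ℕ) c xs → ∑[ x ← xs ] (f x * c) ≡ ∑ xs f * c
∑-*ʳ f c []       = refl
∑-*ʳ f c (x ∷ xs) = trans (cong (f x * c +_) (∑-*ʳ f c xs)) (sym (*-distribʳ-+ c (f x) _))

∑-mono-≤ : ∀ {f g : A → ℕ} xs → (∀ x → x ∈ₗ xs → f x ≤ g x) → ∑ xs f ≤ ∑ xs g
∑-mono-≤ []       f≤g = z≤n
∑-mono-≤ (x ∷ xs) f≤g = +-mono-≤ (f≤g x (here refl)) (∑-mono-≤ xs λ y y∈ → f≤g y (there y∈))

∈⇒≤∑ : ∀ (f : A → ℕ) {x xs} → x ∈ₗ xs → f x ≤ ∑ xs f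
∈⇒≤∑ f {xs = y ∷ ys} (here refl) = m≤m+n (f y) _
∈⇒≤∑ f {xs = y ∷ ys} (there x∈)  = ≤-trans (∈⇒≤∑ f x∈) (m≤n+m _ (f y))

∈-distinct⇒≤∑ : ∀ (f : A → ℕ) {x y xs} → x ∈ₗ xs → y ∈ₗ xs → x ≢ y → f x + f y ≤ ∑ xs f
∈-distinct⇒≤∑ f (here refl) (here refl) x≢y = ⊥-elim (x≢y refl)
∈-distinct⇒≤∑ f (here refl) (there y∈) _ = +-monoʳ-≤ _ (∈⇒≤∑ f y∈)
∈-distinct⇒≤∑ f {x} {y} (there x∈) (here refl) _ =
  ≤-trans (≤-reflexive (+-comm (f x) (f y))) (+-monoʳ-≤ _ (∈⇒≤∑ f x∈))
∈-distinct⇒≤∑ f {xs = z ∷ _} (there x∈) (there y∈) x≢y =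
  ≤-trans (∈-distinct⇒≤∑ f x∈ y∈ x≢y) (m≤n+m _ (f z))

∑-𝟙-≤1 : ∀ (p : A → Bool) {xs} → Unique xs →
         (∀ {x y} → x ∈ₗ xs → y ∈ₗ xs → p x ≡ true → p y ≡ true → x ≡ y) →
         ∑[ x ← xs ] 𝟙 (p x) ≤ 1
∑-𝟙-≤1 p {[]}     _           _      = z≤n
∑-𝟙-≤1 p {x ∷ xs} (x∉xs ∷ !xs) atMost1 with p x in px
... | false = ∑-𝟙-≤1 p !xs λ y∈ z∈ → atMost1 (there y∈) (there z∈)
... | true  = s≤s (≤-reflexive (rest-zero xs x∉xs λ y∈ py → atMost1 (here refl) (there y∈) px py))
  where
  rest-zero : ∀ ys → All (x ≢_) ys → (∀ {y} → y ∈ₗ ys → p y ≡ true → x ≡ y) → ∑[ y ← ys ] 𝟙 (p y) ≡ 0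
  rest-zero []       _            _ = refl
  rest-zero (y ∷ ys) (x≢y ∷ x≢ys) h with p y in py
  ... | true  = ⊥-elim (x≢y (h (here refl) py))
  ... | false = rest-zero ys x≢ys λ z∈ → h (there z∈)

∑𝟙≤1⇒∑𝟙*c≤c : ∀ (p : A → Bool) c xs → ∑[ x ← xs ] 𝟙 (p x) ≤ 1 → ∑[ x ← xs ] (𝟙 (p x) * c) ≤ c
∑𝟙≤1⇒∑𝟙*c≤c p c xs ≤1 = begin
  ∑[ x ← xs ] (𝟙 (p x) * c) ≡⟨ ∑-*ʳ (λ x → 𝟙 (p x)) c xs ⟩
  ∑[ x ← xs ] 𝟙 (p x) * c   ≤⟨ *-monoˡ-≤ c ≤1 ⟩
  1 * c                     ≡⟨ *-identityˡ c ⟩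
  c                         ∎
  where open ≤-Reasoning

∑-1or2+#filterᵇ : ∀ (p : A → Bool) xs →
  ∑[ x ← xs ] (if p x then 1 else 2) + length (filterᵇ p xs) ≡ 2 * length xs
∑-1or2+#filterᵇ p []       = refl
∑-1or2+#filterᵇ p (x ∷ xs) with p x | ∑-1or2+#filterᵇ p xs
... | true  | ih = cong suc (trans (+-suc _ _) (trans (cong suc ih) (sym (+-suc _ _))))
... | false | ih = cong suc (trans (cong suc ih) (sym (+-suc _ _)))

∑-swap : ∀ (R : A → B → ℕ) xs ys → ∑[ x ← xs ] ∑[ y ← ys ] R x y ≡ ∑[ y ← ys ] ∑[ x ← xs ] R x y
∑-swap R []       ys = sym (trans (∑-const 0 ys) (*-zeroʳ (length ys)))
∑-swap R (x ∷ xs) ys = trans (cong (∑ ys (R x) +_) (∑-swap R xs ys)) (sym (∑-+ (R x) _ ys))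

double-counting : ∀ (R : A → B → ℕ) {f : A → ℕ} {g : B → ℕ} xs ys →
  (∀ x → x ∈ₗ xs → f x ≤ ∑[ y ← ys ] R x y) →
  (∀ y → y ∈ₗ ys → ∑[ x ← xs ] R x y ≤ g y) →
  ∑ xs f ≤ ∑ ys g
double-counting R xs ys rows cols = begin
  ∑ xs _                        ≤⟨ ∑-mono-≤ xs rows ⟩
  ∑[ x ← xs ] ∑[ y ← ys ] R x y ≡⟨ ∑-swap R xs ys ⟩
  ∑[ y ← ys ] ∑[ x ← xs ] R x y ≤⟨ ∑-mono-≤ ys cols ⟩
  ∑ ys _                        ∎
  where open ≤-Reasoning

Unique-++⁻ʳ : ∀ xs {ys : List A} → Unique (xs ++ ys) → Unique ys
Unique-++⁻ʳ []       u       = u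
Unique-++⁻ʳ (_ ∷ xs) (_ ∷ u) = Unique-++⁻ʳ xs u

Unique-++⇒disjoint : ∀ xs {ys : List A} {x} → Unique (xs ++ ys) → x ∈ₗ xs → x ∈ₗ ys → ⊥
Unique-++⇒disjoint (_ ∷ xs) (x∉ ∷ _) (here refl) x∈ys = All.lookup x∉ (∈-++⁺ʳ xs x∈ys) refl
Unique-++⇒disjoint (_ ∷ xs) (_ ∷ u)  (there x∈)  x∈ys = Unique-++⇒disjoint xs u x∈ x∈ys

module _ {A : Set} (_≟_ : DecidableEquality A) where

  open import Data.List.Membership.DecPropositional _≟_ using () renaming (_∈?_ to _∈ₗ?_)

  ∑-𝟙-∈-≤1 : ∀ x (xss : List (List A)) → Unique (concat xss) → ∑[ xs ← xss ] 𝟙 (does (x ∈ₗ? xs)) ≤ 1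
  ∑-𝟙-∈-≤1 x []         _ = z≤n
  ∑-𝟙-∈-≤1 x (xs ∷ xss) u with x ∈ₗ? xs
  ... | no _     = ∑-𝟙-∈-≤1 x xss (Unique-++⁻ʳ xs u)
  ... | yes x∈xs =
    s≤s (≤-reflexive (absent xss λ x∈ys ys∈ → Unique-++⇒disjoint xs u x∈xs (∈-concat⁺′ x∈ys ys∈)))
    where
    absent : ∀ yss → (∀ {ys} → x ∈ₗ ys → ys ∈ₗ yss → ⊥) → ∑[ ys ← yss ] 𝟙 (does (x ∈ₗ? ys)) ≡ 0
    absent []         _ = refl
    absent (ys ∷ yss) h with x ∈ₗ? ys
    ... | yes x∈ys = ⊥-elim (h x∈ys (here refl))
    ... | no _     = absent yss λ x∈ ys∈ → h x∈ (there ys∈)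

∣p∣≡∑𝟙 : ∀ {k} (p : Subset k) → ∣ p ∣ ≡ ∑[ v ← allFin k ] 𝟙 (lookup p v)
∣p∣≡∑𝟙 p = trans (count p) (cong sum (sym (map-tabulate id (𝟙 ∘ lookup p))))
  where
  count : ∀ {k} (p : Subset k) → ∣ p ∣ ≡ sum (tabulate (𝟙 ∘ lookup p))
  count []          = refl
  count (true ∷ p)  = cong suc (count p)
  count (false ∷ p) = count p

all-true⇒ : ∀ (p : A → Bool) {xs x} → all p xs ≡ true → x ∈ₗ xs → p x ≡ true
all-true⇒ p {y ∷ ys} h (here refl) = ∧-conicalˡ (p y) _ h
all-true⇒ p {y ∷ ys} h (there x∈) = all-true⇒ p (∧-conicalʳ (p y) _ h) x∈

⇒all-true : ∀ (p : A → Bool) xs → (∀ {x} → x ∈ₗ xs → p x ≡ true) → all p xs ≡ true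
⇒all-true p []       _ = refl
⇒all-true p (x ∷ xs) h rewrite h (here refl) = ⇒all-true p xs (h ∘ there)

all-false⇒ : ∀ (p : A → Bool) xs → all p xs ≡ false → ∃ λ x → x ∈ₗ xs × p x ≡ false
all-false⇒ p (x ∷ xs) h with p x in px
... | false = x , here refl , px
... | true  = let y , y∈ , py = all-false⇒ p xs h in y , there y∈ , py

any-true⇒ : ∀ (p : A → Bool) xs → any p xs ≡ true → ∃ λ x → x ∈ₗ xs × p x ≡ true
any-true⇒ p (x ∷ xs) h with p x in px
... | true  = x , here refl , px
... | false = let y , y∈ , py = any-true⇒ p xs h in y , there y∈ , py

⇒any-true : ∀ (p : A → Bool) {xs x} → x ∈ₗ xs → p x ≡ true → any p xs ≡ true
⇒any-true p (here refl) px rewrite px = refl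
⇒any-true p {y ∷ _} (there x∈) px with p y
... | true  = refl
... | false = ⇒any-true p x∈ px

∈-filterᵇ⁺ : ∀ (p : A → Bool) {xs x} → x ∈ₗ xs → p x ≡ true → x ∈ₗ filterᵇ p xs
∈-filterᵇ⁺ p x∈ px = ∈-filter⁺ (T? ∘ p) x∈ (Equivalence.from T-≡ px)

∈-filterᵇ⁻ : ∀ (p : A → Bool) {xs x} → x ∈ₗ filterᵇ p xs → x ∈ₗ xs × p x ≡ true
∈-filterᵇ⁻ p x∈ = let x∈xs , px = ∈-filter⁻ (T? ∘ p) x∈ in x∈xs , Equivalence.to T-≡ px

≤⇒<ᵇ-suc : ∀ {a b} → a ≤ b → (a <ᵇ suc b) ≡ true
≤⇒<ᵇ-suc a≤b = Equivalence.to T-≡ (<⇒<ᵇ (s≤s a≤b))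

<ᵇ-suc⇒≤ : ∀ {a b} → (a <ᵇ suc b) ≡ true → a ≤ b
<ᵇ-suc⇒≤ h = ≤-pred (<ᵇ⇒< _ _ (Equivalence.from T-≡ h))

∈⇒lookup : ∀ {k} {U : Subset k} {v} → v ∈ U → lookup U v ≡ true
∈⇒lookup = []=⇒lookup

lookup⇒∈ : ∀ {k} {U : Subset k} {v} → lookup U v ≡ true → v ∈ U
lookup⇒∈ {U = U} {v} = lookup⇒[]= v U

lookup≡false⇒∉ : ∀ {k} {U : Subset k} {v} → lookup U v ≡ false → v ∉ U
lookup≡false⇒∉ eq v∈ with () ← trans (sym (∈⇒lookup v∈)) eq

∉⇒lookup≡false : ∀ {k} {U : Subset k} {v} → v ∉ U → lookup U v ≡ false
∉⇒lookup≡false {U = U} {v} v∉ with lookup U v in eq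
... | false = refl
... | true  = ⊥-elim (v∉ (lookup⇒∈ eq))

lookup-∩ : ∀ {k} (X Y : Subset k) v → lookup (X ∩ Y) v ≡ lookup X v ∧ lookup Y v
lookup-∩ X Y v = lookup-zipWith _∧_ v X Y

lookup-∪ : ∀ {k} (X Y : Subset k) v → lookup (X ∪ Y) v ≡ lookup X v ∨ lookup Y v
lookup-∪ X Y v = lookup-zipWith _∨_ v X Y

module _ {n m : ℕ} (G : Digraph n m) where

  allSubsets-complete : ∀ {k} (U : Subset k) → U ∈ₗ allSubsets G k
  allSubsets-complete []          = here refl
  allSubsets-complete (true ∷ U)  = ∈-++⁺ˡ (∈-map⁺ (true ∷_) (allSubsets-complete U))
  allSubsets-complete (false ∷ U) = ∈-++⁺ʳ _ (∈-map⁺ (false ∷_) (allSubsets-complete U))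

  allSubsets-unique : ∀ k → Unique (allSubsets G k)
  allSubsets-unique zero    = All.[] ∷ []
  allSubsets-unique (suc k) =
    Unique.++⁺ (Unique.map⁺ ∷-injectiveʳ (allSubsets-unique k))
               (Unique.map⁺ ∷-injectiveʳ (allSubsets-unique k)) heads-differ
    where
    ∷-injectiveʳ : ∀ {b} {U W : Subset k} → (Subset (suc k) ∋ b ∷ U) ≡ b ∷ W → U ≡ W
    ∷-injectiveʳ refl = refl
    heads-differ : ∀ {U} → U ∈ₗ map (true ∷_) (allSubsets G k) × U ∈ₗ map (false ∷_) (allSubsets G k) → ⊥
    heads-differ (U∈₁ , U∈₂) with ∈-map⁻ (true ∷_) U∈₁ | ∈-map⁻ (false ∷_) U∈₂
    ... | _ , _ , refl | _ , _ , ()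

  subsetᵇ⇒⊆ : ∀ {W U} → subsetᵇ G W U ≡ true → W ⊆ U
  subsetᵇ⇒⊆ h {v} v∈W = lookup⇒∈ (not-∨-elim (∈⇒lookup v∈W) (all-true⇒ _ h (∈-allFin v)))
    where
    not-∨-elim : ∀ {a b} → a ≡ true → not a ∨ b ≡ true → b ≡ true
    not-∨-elim refl h = h

  ⊆⇒subsetᵇ : ∀ {W U} → W ⊆ U → subsetᵇ G W U ≡ true
  ⊆⇒subsetᵇ W⊆U = ⇒all-true _ (allFin n) λ _ → not-∨-intro (∈⇒lookup ∘ W⊆U ∘ lookup⇒∈)
    where
    not-∨-intro : ∀ {a b} → (a ≡ true → b ≡ true) → not a ∨ b ≡ true
    not-∨-intro {false} _ = refl
    not-∨-intro {true}  f = f refl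

  eqᵇ-refl : ∀ U → eqᵇ G U U ≡ true
  eqᵇ-refl U rewrite ⊆⇒subsetᵇ {U} ⊆-refl = refl

  properSubsetᵇ⇒⊂ : ∀ {W U} → properSubsetᵇ G W U ≡ true → W ⊂ U
  properSubsetᵇ⇒⊂ {W} {U} h with subsetᵇ G W U in W⊆ᵇU | subsetᵇ G U W in U⊆ᵇW
  ... | true | false =
    let v , _ , v∈U∖W = all-false⇒ _ (allFin n) U⊆ᵇW
        v∈U , v∉W = not-∨-false v∈U∖W
    in subsetᵇ⇒⊆ W⊆ᵇU , v , lookup⇒∈ v∈U , lookup≡false⇒∉ v∉W
    where
    not-∨-false : ∀ {a b} → not a ∨ b ≡ false → a ≡ true × b ≡ false
    not-∨-false {true} {false} _ = refl , refl

  ⊆∧¬properSubsetᵇ⇒≡ : ∀ {W U} → W ⊆ U → properSubsetᵇ G W U ≡ false → W ≡ U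
  ⊆∧¬properSubsetᵇ⇒≡ {W} {U} W⊆U h rewrite ⊆⇒subsetᵇ W⊆U =
    ⊆-antisym W⊆U (subsetᵇ⇒⊆ (not-injective h))

  entering : Subset m → Subset n → Fin m → Bool
  entering H U e = lookup H e ∧ not (lookup U (tail G e)) ∧ lookup U (head G e)

  inDeg-mono : ∀ {H H′} U → H ⊆ H′ → inDeg G H U ≤ inDeg G H′ U
  inDeg-mono {H} {H′} U H⊆H′ = ∑-mono-≤ (allFin m) λ e _ → entering-mono e
    where
    entering-mono : ∀ e → 𝟙 (entering H U e) ≤ 𝟙 (entering H′ U e)
    entering-mono e with lookup H e in e∈H
    ... | false = z≤n
    ... | true rewrite ∈⇒lookup (H⊆H′ (lookup⇒∈ e∈H)) = ≤-refl

  inDeg-submodular : ∀ H X Y → inDeg G H (X ∩ Y) + inDeg G H (X ∪ Y) ≤ inDeg G H X + inDeg G H Y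
  inDeg-submodular H X Y = begin
    inDeg G H (X ∩ Y) + inDeg G H (X ∪ Y)
      ≡⟨ ∑-+ (𝟙 ∘ entering H (X ∩ Y)) (𝟙 ∘ entering H (X ∪ Y)) (allFin m) ⟨
    ∑[ e ← allFin m ] (𝟙 (entering H (X ∩ Y) e) + 𝟙 (entering H (X ∪ Y) e))
      ≤⟨ ∑-mono-≤ (allFin m) (λ e _ → per-edge e) ⟩
    ∑[ e ← allFin m ] (𝟙 (entering H X e) + 𝟙 (entering H Y e))
      ≡⟨ ∑-+ (𝟙 ∘ entering H X) (𝟙 ∘ entering H Y) (allFin m) ⟩
    inDeg G H X + inDeg G H Y
      ∎
    where
    open ≤-Reasoning
    truth-table : ∀ h xt yt xh yh →
      𝟙 (h ∧ not (xt ∧ yt) ∧ (xh ∧ yh)) + 𝟙 (h ∧ not (xt ∨ yt) ∧ (xh ∨ yh)) ≤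
      𝟙 (h ∧ not xt ∧ xh) + 𝟙 (h ∧ not yt ∧ yh)
    truth-table false _     _     _     _     = z≤n
    truth-table true  true  true  _     _     = z≤n
    truth-table true  true  false true  true  = ≤-refl
    truth-table true  true  false true  false = z≤n
    truth-table true  true  false false true  = z≤n
    truth-table true  true  false false false = z≤n
    truth-table true  false true  true  true  = ≤-refl
    truth-table true  false true  true  false = z≤n
    truth-table true  false true  false true  = z≤n
    truth-table true  false true  false false = z≤n
    truth-table true  false false true  true  = ≤-refl
    truth-table true  false false true  false = ≤-refl
    truth-table true  false false false true  = ≤-refl
    truth-table true  false false false false = z≤n
    per-edge : ∀ e → 𝟙 (entering H (X ∩ Y) e) + 𝟙 (entering H (X ∪ Y) e) ≤
                     𝟙 (entering H X e) + 𝟙 (entering H Y e)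
    per-edge e
      rewrite lookup-∩ X Y (tail G e) | lookup-∩ X Y (head G e)
            | lookup-∪ X Y (tail G e) | lookup-∪ X Y (head G e)
      = truth-table (lookup H e) (lookup X (tail G e)) (lookup Y (tail G e))
                                 (lookup X (head G e)) (lookup Y (head G e))

  open import Data.List.Membership.DecPropositional (Fin._≟_ {m}) using () renaming (_∈?_ to _∈ₗ?_)

  walk-enters : ∀ {H U u t es} → Walk G H u t es → u ∉ U → t ∈ U →
    ∃ λ e → e ∈ₗ es × e ∈ H × tail G e ∉ U × head G e ∈ U
  walk-enters nil u∉U t∈U = ⊥-elim (u∉U t∈U)
  walk-enters {U = U} (cons {e = e} e∈H refl w) tail∉U t∈U with head G e ∈? U
  ... | yes head∈U = e , here refl , e∈H , tail∉U , head∈U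
  ... | no head∉U  = let e′ , e′∈ , rest = walk-enters w head∉U t∈U in e′ , there e′∈ , rest

  edge-disjoint-walks≤inDeg : ∀ {H U u t} (ps : List (List (Fin m))) →
    All (Walk G H u t) ps → Unique (concat ps) → u ∉ U → t ∈ U → length ps ≤ inDeg G H U
  edge-disjoint-walks≤inDeg {H} {U} ps walks disjoint u∉U t∈U = begin
    length ps                         ≡⟨ *-identityʳ (length ps) ⟨
    length ps * 1                     ≡⟨ ∑-const 1 ps ⟨
    ∑[ _ ← ps ] 1                     ≤⟨ double-counting R ps (allFin m) crossing at-most-once ⟩
    ∑[ e ← allFin m ] 𝟙 (entering H U e) ∎
    where
    open ≤-Reasoning
    R : List (Fin m) → Fin m → ℕ
    R p e = 𝟙 (does (e ∈ₗ? p)) * 𝟙 (entering H U e)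
    crossing : ∀ p → p ∈ₗ ps → 1 ≤ ∑[ e ← allFin m ] R p e
    crossing p p∈ with walk-enters (All.lookup walks p∈) u∉U t∈U
    ... | e , e∈p , e∈H , tail∉U , head∈U = ≤-trans one (∈⇒≤∑ (R p) (∈-allFin e))
      where
      one : 1 ≤ R p e
      one with e ∈ₗ? p
      ... | no e∉p = ⊥-elim (e∉p e∈p)
      ... | yes _ rewrite ∈⇒lookup e∈H | ∉⇒lookup≡false tail∉U | ∈⇒lookup head∈U = ≤-refl
    at-most-once : ∀ e → e ∈ₗ allFin m → ∑[ p ← ps ] R p e ≤ 𝟙 (entering H U e)
    at-most-once e _ = ∑𝟙≤1⇒∑𝟙*c≤c (λ p → does (e ∈ₗ? p)) _ ps (∑-𝟙-∈-≤1 Fin._≟_ e ps disjoint)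

shrink-arithmetic : ∀ n′ n {w c} → n′ * 2 ≤ w → w + c ≡ 2 * n → n ≤ 9 * c → 18 * n′ ≤ 17 * n
shrink-arithmetic n′ n {w} {c} n′*2≤w w+c≡2n n≤9c = +-cancelʳ-≤ n (18 * n′) (17 * n) (begin
  18 * n′ + n           ≡⟨ cong (_+ n) (trans (*-comm 18 n′) (sym (*-assoc n′ 2 9))) ⟩
  n′ * 2 * 9 + n        ≤⟨ +-mono-≤ (*-monoˡ-≤ 9 n′*2≤w) n≤9c ⟩
  w * 9 + 9 * c         ≡⟨ cong (_+ 9 * c) (*-comm w 9) ⟩
  9 * w + 9 * c         ≡⟨ *-distribˡ-+ 9 w c ⟨
  9 * (w + c)           ≡⟨ cong (9 *_) w+c≡2n ⟩
  9 * (2 * n)           ≡⟨ *-assoc 9 2 n ⟨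
  18 * n                ≡⟨ +-comm n (17 * n) ⟩
  17 * n + n            ∎)
  where open ≤-Reasoning

2^L≤q⇒L≤⌊log₂q⌋ : ∀ {L q} → 2 ^ L ≤ q → L ≤ ⌊log₂ q ⌋
2^L≤q⇒L≤⌊log₂q⌋ {L} 2^L≤q = subst (_≤ _) (⌊log₂[2^n]⌋≡n L) (⌊log₂⌋-mono-≤ 2^L≤q)

2^L*x^L≤y^L : ∀ {x y} → 2 * x ≤ y → ∀ L → 2 ^ L * x ^ L ≤ y ^ L
2^L*x^L≤y^L 2x≤y zero    = ≤-refl
2^L*x^L≤y^L {x} {y} 2x≤y (suc L) = begin
  2 * 2 ^ L * (x * x ^ L)   ≡⟨ *-interchange 2 (2 ^ L) x (x ^ L) ⟩
  2 * x * (2 ^ L * x ^ L)   ≤⟨ *-mono-≤ 2x≤y (2^L*x^L≤y^L 2x≤y L) ⟩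
  y * y ^ L                 ∎
  where open ≤-Reasoning

geometric-decay : ∀ {a b k} (N : ℕ → ℕ) → (∀ i → i < k → b * N (suc i) ≤ a * N i) →
  ∀ i → i ≤ k → b ^ i * N i ≤ a ^ i * N 0
geometric-decay N step zero    _ = ≤-refl
geometric-decay {a} {b} N step (suc i) i<k = begin
  b * b ^ i * N (suc i)   ≡⟨ *-assoc b (b ^ i) _ ⟩
  b * (b ^ i * N (suc i)) ≡⟨ x*[y*z]≡y*[x*z] b (b ^ i) _ ⟩
  b ^ i * (b * N (suc i)) ≤⟨ *-monoʳ-≤ (b ^ i) (step i i<k) ⟩
  b ^ i * (a * N i)       ≡⟨ x*[y*z]≡y*[x*z] (b ^ i) a _ ⟩
  a * (b ^ i * N i)       ≤⟨ *-monoʳ-≤ a (geometric-decay N step i (<⇒≤ i<k)) ⟩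
  a * (a ^ i * N 0)       ≡⟨ *-assoc a (a ^ i) (N 0) ⟨
  a * a ^ i * N 0         ∎
  where open ≤-Reasoning

rounds≤c*log : ∀ a b c .{{_ : NonZero a}} → 2 * a ^ c ≤ b ^ c →
  (N : ℕ → ℕ) (q k : ℕ) → N 0 ≤ q → (∀ i → i < k → 1 ≤ N i) →
  (∀ i → i < k → b * N (suc i) ≤ a * N i) → k ≤ c * suc ⌊log₂ q ⌋
rounds≤c*log a b c 2a^c≤b^c N q k N₀≤q positive step with k ≤? c * suc ⌊log₂ q ⌋
... | yes k≤ = k≤
... | no  k≰ = ⊥-elim (<-irrefl refl (2^L≤q⇒L≤⌊log₂q⌋ 2^L≤q))
  where
  L = suc ⌊log₂ q ⌋
  j = c * L
  j<k : j < k
  j<k = ≰⇒> k≰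
  instance
    a^j≢0 : NonZero (a ^ j)
    a^j≢0 = m^n≢0 a j
  open ≤-Reasoning
  2^L≤q : 2 ^ L ≤ q
  2^L≤q = *-cancelʳ-≤ (2 ^ L) q (a ^ j) (begin
    2 ^ L * a ^ j       ≡⟨ cong (2 ^ L *_) (^-*-assoc a c L) ⟨
    2 ^ L * (a ^ c) ^ L ≤⟨ 2^L*x^L≤y^L {a ^ c} 2a^c≤b^c L ⟩
    (b ^ c) ^ L         ≡⟨ ^-*-assoc b c L ⟩
    b ^ j               ≡⟨ *-identityʳ (b ^ j) ⟨
    b ^ j * 1           ≤⟨ *-monoʳ-≤ (b ^ j) (positive j j<k) ⟩
    b ^ j * N j         ≤⟨ geometric-decay N step j (<⇒≤ j<k) ⟩
    a ^ j * N 0         ≤⟨ *-monoʳ-≤ (a ^ j) N₀≤q ⟩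
    a ^ j * q           ≡⟨ *-comm (a ^ j) q ⟩
    q * a ^ j           ∎)

-- Deficient sets, cores and halos

module _ {n m : ℕ} (G : Digraph n m) (r : Fin n) (T : Subset n) (ℓ : ℕ) where

  private
    Cores : Subset m → List (Subset n)
    Cores = cores G r T ℓ

  -- By Menger's theorem this is equivalent to rooted ℓ-connectivity; only the easy
  -- direction is needed.
  record CutCondition (H : Subset m) : Set where
    field
      enough-entering : ∀ {U t} → r ∉ U → t ∈ U → t ∈ T → ℓ ≤ inDeg G H U
  open CutCondition

  rootedConnected⇒cutCondition : ∀ {H} → RootedConnected G H r T ℓ → CutCondition H
  rootedConnected⇒cutCondition rc .enough-entering r∉U t∈U t∈T with rc _ t∈T
  ... | ps , refl , paths , disjoint =
    edge-disjoint-walks≤inDeg G ps (All.map proj₁ paths) disjoint r∉U t∈U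

  cutCondition-mono : ∀ {H H′} → H ⊆ H′ → CutCondition H → CutCondition H′
  cutCondition-mono H⊆H′ cut .enough-entering {U} r∉U t∈U t∈T =
    ≤-trans (cut .enough-entering r∉U t∈U t∈T) (inDeg-mono G U H⊆H′)

  record Deficient (H : Subset m) (U : Subset n) : Set where
    field
      root∉ : r ∉ U
      terminal : ∃ λ t → t ∈ U × t ∈ T
      few-entering : inDeg G H U ≤ ℓ
  open Deficient

  module _ {H : Subset m} {U : Subset n} where

    deficient⇒Deficient : deficient G r T ℓ H U ≡ true → Deficient H U
    deficient⇒Deficient h with lookup U r in r∈ᵇU
    ... | false = record
      { root∉ = lookup≡false⇒∉ r∈ᵇU
      ; terminal =
          let t , _ , t∈U∩T = any-true⇒ _ (allFin n) (∧-conicalˡ _ _ h)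
          in t , lookup⇒∈ (∧-conicalˡ _ _ t∈U∩T) , lookup⇒∈ (∧-conicalʳ _ _ t∈U∩T)
      ; few-entering = <ᵇ-suc⇒≤ (∧-conicalʳ _ _ h)
      }

    Deficient⇒deficient : Deficient H U → deficient G r T ℓ H U ≡ true
    Deficient⇒deficient record { root∉ = r∉U ; terminal = t , t∈U , t∈T ; few-entering = few }
      rewrite ∉⇒lookup≡false r∉U
            | ⇒any-true (λ v → lookup U v ∧ lookup T v) (∈-allFin t)
                        (cong₂ _∧_ (∈⇒lookup t∈U) (∈⇒lookup t∈T))
      = ≤⇒<ᵇ-suc few

  Deficient-anti-mono : ∀ {H H′ U} → H ⊆ H′ → Deficient H′ U → Deficient H U
  Deficient-anti-mono {U = U} H⊆H′ d = record
    { root∉ = d .root∉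
    ; terminal = d .terminal
    ; few-entering = ≤-trans (inDeg-mono G U H⊆H′) (d .few-entering)
    }

  Deficient-∩ : ∀ {H X Y t} → CutCondition H → Deficient H X → Deficient H Y →
    t ∈ X → t ∈ Y → t ∈ T → Deficient H (X ∩ Y)
  Deficient-∩ {H} {X} {Y} {t} cut dX dY t∈X t∈Y t∈T = record
    { root∉ = dX .root∉ ∘ proj₁ ∘ x∈p∩q⁻ X Y
    ; terminal = t , x∈p∩q⁺ (t∈X , t∈Y) , t∈T
    ; few-entering = +-cancelʳ-≤ ℓ _ _ (begin
        inDeg G H (X ∩ Y) + ℓ                 ≤⟨ +-monoʳ-≤ _ ℓ≤inDeg[X∪Y] ⟩
        inDeg G H (X ∩ Y) + inDeg G H (X ∪ Y) ≤⟨ inDeg-submodular G H X Y ⟩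
        inDeg G H X + inDeg G H Y             ≤⟨ +-mono-≤ (dX .few-entering) (dY .few-entering) ⟩
        ℓ + ℓ                                 ∎)
    }
    where
    open ≤-Reasoning
    r∉X∪Y : r ∉ X ∪ Y
    r∉X∪Y r∈ with x∈p∪q⁻ X Y r∈
    ... | inj₁ r∈X = dX .root∉ r∈X
    ... | inj₂ r∈Y = dY .root∉ r∈Y
    ℓ≤inDeg[X∪Y] : ℓ ≤ inDeg G H (X ∪ Y)
    ℓ≤inDeg[X∪Y] = cut .enough-entering r∉X∪Y (x∈p∪q⁺ (inj₁ t∈X)) t∈T

  module _ (H : Subset m) where

    private
      minimal : Subset n → Bool
      minimal U = all (λ W → not (properSubsetᵇ G W U ∧ deficient G r T ℓ H W)) (allSubsets G n)

      core⇒isCore : ∀ {C} → C ∈ₗ Cores H → isCore G r T ℓ H C ≡ true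
      core⇒isCore C∈ = proj₂ (∈-filterᵇ⁻ (isCore G r T ℓ H) {allSubsets G n} C∈)

      core⇒minimal : ∀ {C} → C ∈ₗ Cores H → minimal C ≡ true
      core⇒minimal C∈ = ∧-conicalʳ _ _ (core⇒isCore C∈)

    core⇒Deficient : ∀ {C} → C ∈ₗ Cores H → Deficient H C
    core⇒Deficient C∈ = deficient⇒Deficient (∧-conicalˡ _ _ (core⇒isCore C∈))

    core-minimal : ∀ {C W} → C ∈ₗ Cores H → W ⊆ C → Deficient H W → W ≡ C
    core-minimal {C} {W} C∈ W⊆C dW =
      ⊆∧¬properSubsetᵇ⇒≡ G W⊆C
        (not-∧-true (all-true⇒ _ (core⇒minimal C∈) (allSubsets-complete G W)) (Deficient⇒deficient dW))
      where
      not-∧-true : ∀ {a b} → not (a ∧ b) ≡ true → b ≡ true → a ≡ false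
      not-∧-true {false} _  _  = refl
      not-∧-true {true}  {true}  () _

    cores-unique : Unique (Cores H)
    cores-unique = Unique.filter⁺ (T? ∘ isCore G r T ℓ H) (allSubsets-unique G n)

    Deficient⇒⊇core : ∀ {U} → Deficient H U → ∃ λ C → C ∈ₗ Cores H × C ⊆ U
    Deficient⇒⊇core {U} = descend (<-wellFounded ∣ U ∣)
      where
      descend : ∀ {U} → Acc _<_ ∣ U ∣ → Deficient H U → ∃ λ C → C ∈ₗ Cores H × C ⊆ U
      descend {U} (acc smaller) dU with minimal U in U-minimal
      ... | true  = U , ∈-filterᵇ⁺ (isCore G r T ℓ H) (allSubsets-complete G U) U-core , ⊆-refl
        where
        U-core : isCore G r T ℓ H U ≡ true
        U-core = cong₂ _∧_ (Deficient⇒deficient dU) U-minimal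
      ... | false with all-false⇒ _ (allSubsets G n) U-minimal
      ... | W , _ , W-witness =
        let C , C∈ , C⊆W = descend (smaller (p⊂q⇒∣p∣<∣q∣ W⊂U)) dW
        in C , C∈ , ⊆-trans C⊆W (proj₁ W⊂U)
        where
        W⊂ᵇU∧dW : properSubsetᵇ G W U ∧ deficient G r T ℓ H W ≡ true
        W⊂ᵇU∧dW = not-injective W-witness
        W⊂U : W ⊂ U
        W⊂U = properSubsetᵇ⇒⊂ G (∧-conicalˡ (properSubsetᵇ G W U) _ W⊂ᵇU∧dW)
        dW : Deficient H W
        dW = deficient⇒Deficient (∧-conicalʳ (properSubsetᵇ G W U) _ W⊂ᵇU∧dW)

  cores-sharing-terminal : ∀ {H C₁ C₂ t} → CutCondition H →
    C₁ ∈ₗ Cores H → C₂ ∈ₗ Cores H → t ∈ C₁ → t ∈ C₂ → t ∈ T → C₁ ≡ C₂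
  cores-sharing-terminal {H} {C₁} {C₂} cut C₁∈ C₂∈ t∈C₁ t∈C₂ t∈T =
    trans (sym (core-minimal H C₁∈ (p∩q⊆p C₁ C₂) d∩)) (core-minimal H C₂∈ (p∩q⊆q C₁ C₂) d∩)
    where
    d∩ : Deficient H (C₁ ∩ C₂)
    d∩ = Deficient-∩ cut (core⇒Deficient H C₁∈) (core⇒Deficient H C₂∈) t∈C₁ t∈C₂ t∈T

  #cores≤#terminals : ∀ {H} → CutCondition H → length (Cores H) ≤ ∣ T ∣
  #cores≤#terminals {H} cut = begin
    length (Cores H)                 ≡⟨ *-identityʳ _ ⟨
    length (Cores H) * 1             ≡⟨ ∑-const 1 (Cores H) ⟨
    ∑[ _ ← Cores H ] 1               ≤⟨ double-counting R (Cores H) (allFin n)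
                                                         core-has-terminal terminal-in-one-core ⟩
    ∑[ v ← allFin n ] 𝟙 (lookup T v) ≡⟨ ∣p∣≡∑𝟙 T ⟨
    ∣ T ∣                            ∎
    where
    open ≤-Reasoning
    R : Subset n → Fin n → ℕ
    R C v = 𝟙 (lookup C v) * 𝟙 (lookup T v)
    core-has-terminal : ∀ C → C ∈ₗ Cores H → 1 ≤ ∑[ v ← allFin n ] R C v
    core-has-terminal C C∈ with core⇒Deficient H C∈ .terminal
    ... | t , t∈C , t∈T = ≤-trans (≤-reflexive (sym R[C,t]≡1)) (∈⇒≤∑ (R C) (∈-allFin t))
      where
      R[C,t]≡1 : R C t ≡ 1
      R[C,t]≡1 rewrite ∈⇒lookup t∈C | ∈⇒lookup t∈T = refl
    terminal-in-one-core : ∀ v → v ∈ₗ allFin n → ∑[ C ← Cores H ] R C v ≤ 𝟙 (lookup T v)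
    terminal-in-one-core v _ with lookup T v in v∈ᵇT
    ... | false = ≤-reflexive (trans (∑-*ʳ (𝟙 ∘ flip lookup v) 0 (Cores H))
                                     (*-zeroʳ (∑ (Cores H) (𝟙 ∘ flip lookup v))))
    ... | true  = ∑𝟙≤1⇒∑𝟙*c≤c (flip lookup v) 1 (Cores H) (∑-𝟙-≤1 (flip lookup v) (cores-unique H)
      λ C₁∈ C₂∈ v∈C₁ v∈C₂ →
        cores-sharing-terminal cut C₁∈ C₂∈ (lookup⇒∈ v∈C₁) (lookup⇒∈ v∈C₂) (lookup⇒∈ v∈ᵇT))

  covered-halo⇒another-core : ∀ {H E C U} → covers G r T ℓ H E C ≡ true → Deficient H U → C ⊆ U →
    inDeg G (H ∪ E) U ≤ ℓ → ∃ λ C′ → C′ ∈ₗ Cores H × C′ ≢ C × C′ ⊆ U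
  covered-halo⇒another-core {H} {E} {C} {U} covered dU C⊆U few
    with all (λ C′ → eqᵇ G C′ C ∨ not (subsetᵇ G C′ U)) (Cores H) in only-core
  ... | true = ⊥-elim (both-false U∈halo (≤⇒<ᵇ-suc few) (all-true⇒ _ covered (allSubsets-complete G U)))
    where
    U∈halo : inHalo G r T ℓ H C U ≡ true
    U∈halo = cong₂ _∧_ (Deficient⇒deficient dU) (cong₂ _∧_ (⊆⇒subsetᵇ G C⊆U) only-core)
    both-false : ∀ {a b} → a ≡ true → b ≡ true → not a ∨ not b ≡ true → ⊥
    both-false refl refl ()
  ... | false with all-false⇒ _ (Cores H) only-core
  ... | C′ , C′∈ , other = C′ , C′∈ , C′≢C , subsetᵇ⇒⊆ G (not-injective (∨-conicalʳ _ _ other))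
    where
    C′≢C : C′ ≢ C
    C′≢C refl with () ← trans (sym (eqᵇ-refl G C′)) (∨-conicalˡ _ _ other)

  module _ {H E : Subset m} (cut : CutCondition H) where

    weight : Subset n → ℕ
    weight C = if covers G r T ℓ H E C then 1 else 2

    credit : Subset n → Subset n → ℕ
    credit C′ C = 𝟙 (subsetᵇ G C C′) * weight C

    new-core-credit : ∀ C′ → C′ ∈ₗ Cores (H ∪ E) → 2 ≤ ∑[ C ← Cores H ] credit C′ C
    new-core-credit C′ C′∈ = let C₀ , C₀∈ , C₀⊆C′ = Deficient⇒⊇core H dC′ in from-core C₀∈ C₀⊆C′
      where
      dC′ : Deficient H C′
      dC′ = Deficient-anti-mono (p⊆p∪q E) (core⇒Deficient (H ∪ E) C′∈)
      credit≥1 : ∀ {C} → C ⊆ C′ → 1 ≤ credit C′ C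
      credit≥1 {C} C⊆C′ rewrite ⊆⇒subsetᵇ G C⊆C′ with covers G r T ℓ H E C
      ... | true  = ≤-refl
      ... | false = s≤s z≤n
      from-core : ∀ {C₀} → C₀ ∈ₗ Cores H → C₀ ⊆ C′ → 2 ≤ ∑[ C ← Cores H ] credit C′ C
      from-core {C₀} C₀∈ C₀⊆C′ with covers G r T ℓ H E C₀ in C₀-covered
      ... | false = ≤-trans (≤-reflexive (sym uncovered)) (∈⇒≤∑ (credit C′) C₀∈)
        where
        uncovered : credit C′ C₀ ≡ 2
        uncovered rewrite ⊆⇒subsetᵇ G C₀⊆C′ | C₀-covered = refl
      ... | true =
        let C₁ , C₁∈ , C₁≢C₀ , C₁⊆C′ =
              covered-halo⇒another-core C₀-covered dC′ C₀⊆C′ (core⇒Deficient (H ∪ E) C′∈ .few-entering)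
        in ≤-trans (+-mono-≤ (credit≥1 C₁⊆C′) (credit≥1 C₀⊆C′)) (∈-distinct⇒≤∑ (credit C′) C₁∈ C₀∈ C₁≢C₀)

    old-core-in-one-new-core : ∀ C → C ∈ₗ Cores H → ∑[ C′ ← Cores (H ∪ E) ] 𝟙 (subsetᵇ G C C′) ≤ 1
    old-core-in-one-new-core C C∈ with core⇒Deficient H C∈ .terminal
    ... | t , t∈C , t∈T = ∑-𝟙-≤1 (subsetᵇ G C) (cores-unique (H ∪ E)) λ C₁∈ C₂∈ C⊆C₁ C⊆C₂ →
      cores-sharing-terminal (cutCondition-mono (p⊆p∪q E) cut) C₁∈ C₂∈
        (subsetᵇ⇒⊆ G C⊆C₁ t∈C) (subsetᵇ⇒⊆ G C⊆C₂ t∈C) t∈T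

    #cores-shrinks : length (Cores H) ≤ 9 * coveredHalos G r T ℓ H E →
      18 * length (Cores (H ∪ E)) ≤ 17 * length (Cores H)
    #cores-shrinks =
      shrink-arithmetic (length (Cores (H ∪ E))) (length (Cores H)) credit-bound
        (∑-1or2+#filterᵇ (covers G r T ℓ H E) (Cores H))
      where
      open ≤-Reasoning
      old-core-credited-once : ∀ C → C ∈ₗ Cores H → ∑[ C′ ← Cores (H ∪ E) ] credit C′ C ≤ weight C
      old-core-credited-once C C∈ =
        ∑𝟙≤1⇒∑𝟙*c≤c (subsetᵇ G C) (weight C) (Cores (H ∪ E)) (old-core-in-one-new-core C C∈)
      credit-bound : length (Cores (H ∪ E)) * 2 ≤ ∑ (Cores H) weight
      credit-bound = begin
        length (Cores (H ∪ E)) * 2 ≡⟨ ∑-const 2 (Cores (H ∪ E)) ⟨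
        ∑[ _ ← Cores (H ∪ E) ] 2  ≤⟨ double-counting credit (Cores (H ∪ E)) (Cores H)
                                                      new-core-credit old-core-credited-once ⟩
        ∑ (Cores H) weight        ∎

-- Runs of the procedure

module _ {n m : ℕ} (G : Digraph n m) (r : Fin n) (T : Subset n) (ℓ : ℕ) {Hℓ : Subset m}
         (rc : RootedConnected G Hℓ r T ℓ) {k : ℕ} {H E : ℕ → Subset m} (run : Run G r T ℓ Hℓ k H E) where

  private
    #cores : ℕ → ℕ
    #cores i = length (cores G r T ℓ (H i))

    has-deficient : ∀ i → i < k → hasDeficient G r T ℓ (H i) ≡ true
    has-deficient i i<k = proj₁ (proj₂ run i i<k)

    covers-ninth : ∀ i → i < k → #cores i ≤ 9 * coveredHalos G r T ℓ (H i) (E i)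
    covers-ninth i i<k = proj₁ (proj₂ (proj₂ run i i<k))

    adds-E : ∀ i → i < k → H (suc i) ≡ H i ∪ E i
    adds-E i i<k = proj₂ (proj₂ (proj₂ run i i<k))

  run-cutCondition : ∀ i → i ≤ k → CutCondition G r T ℓ (H i)
  run-cutCondition zero    _   =
    subst (CutCondition G r T ℓ) (sym (proj₁ run)) (rootedConnected⇒cutCondition G r T ℓ rc)
  run-cutCondition (suc i) i<k =
    subst (CutCondition G r T ℓ) (sym (adds-E i i<k))
      (cutCondition-mono G r T ℓ (p⊆p∪q (E i)) (run-cutCondition i (<⇒≤ i<k)))

  run-has-core : ∀ i → i < k → 1 ≤ #cores i
  run-has-core i i<k =
    let U , _ , dU = any-true⇒ _ (allSubsets G n) (has-deficient i i<k)
        _ , C∈ , _ = Deficient⇒⊇core G r T ℓ (H i) (deficient⇒Deficient G r T ℓ {U = U} dU)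
    in nonempty C∈
    where
    nonempty : ∀ {x : A} {xs} → x ∈ₗ xs → 1 ≤ length xs
    nonempty (here _)  = s≤s z≤n
    nonempty (there _) = s≤s z≤n

  run-shrinks : ∀ i → i < k → 18 * #cores (suc i) ≤ 17 * #cores i
  run-shrinks i i<k rewrite adds-E i i<k =
    #cores-shrinks G r T ℓ (run-cutCondition i (<⇒≤ i<k)) (covers-ninth i i<k)

corollary10 : Σ ℕ λ c →
    ∀ {n m} (G : Digraph n m) (r : Fin n) (T : Subset n) (ℓ : ℕ) (Hℓ : Subset m) →
    r ∉ T → RootedConnected G Hℓ r T ℓ →
    (k : ℕ) (H E : ℕ → Subset m) → Run G r T ℓ Hℓ k H E →
    k ≤ c * suc ⌊log₂ ∣ T ∣ ⌋
corollary10 = 13 , λ G r T ℓ Hℓ _ rc k H E run →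
  rounds≤c*log 17 18 13 (≤ᵇ⇒≤ _ _ _) (λ i → length (cores G r T ℓ (H i))) ∣ T ∣ k
    (#cores≤#terminals G r T ℓ (run-cutCondition G r T ℓ rc run 0 z≤n))
    (run-has-core G r T ℓ rc run) (run-shrinks G r T ℓ rc run)
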